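{- Let $n,k$ be positive integers with $k \mid n$, and let the vertex set of $K_n$ be partitioned into $k$ classes $V_1 \,\dot\cup\, \ldots \,\dot\cup\, V_k$, each of size $n/k$. Let $X$ be the set of all edges $\{v_i,v_j\}$ with $v_i\in V_i$, $v_j\in V_j$, $i\neq j$, and let $\mathcal{F}$ be the family of edge sets $\binom{S}{2}$ of all $k$-cliques $S$ with $|S\cap V_i|=1$ for every $1\le i\le k$. For $E\in\mathcal{F}$ let $V(E)$ denote its vertex set (so $|V(E)|=k$). Let $\mathcal{F}_2^4$ be the family of all unions $E_1\cup E_2\cup E_3\cup E_4$ of four distinct members $E_1,\ldots,E_4$ of $\mathcal{F}$ with $|E_1\cap E_2\cap E_3\cap E_4|\ge 2$ (such unions are called clusters; equivalently the four cliques share a common triangle). To each cluster $F=E_1\cup E_2\cup E_3\cup E_4$ assign a sequence $(m_1,m_2,m_3)$ given, for some chosen ordering of $E_1,\ldots,E_4$, by $m_1=|V(E_1)\cap V(E_2)|$, $m_2=|(V(E_1)\cup V(E_2))\cap V(E_3)|$, $m_3=|(V(E_1)\cup V(E_2)\cup V(E_3))\cap V(E_4)|$, and let $\mathcal{F}_2^4(m_1,m_2,m_3)$ denote the set of clusters assigned the sequence $(m_1,m_2,m_3)$. Then for fixed $3\le m_1,m_2,m_3\le k$, $$\left|\mathcal{F}_2^4(m_1,m_2,m_3)\right| \le \binom{k}{3}\left(\frac{n}{k}\right)^{4k}\prod_{j=1}^{3}\binom{jk}{m_j-3}\left(\frac{k}{n}\right)^{m_j}.$$ Furthermore, every cluster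 $F\in\mathcal{F}_2^4(m_1,m_2,m_3)$ satisfies $|F|\ge 4\binom{k}{2}-\binom{m_1}{2}-\binom{m_2}{2}-\binom{m_3}{2}$.
   Context: This arises in the proof that Maker wins the $k$-tournament game: Maker partitions $V(K_n)$ into $k$ equal classes identified with the vertices of the target tournament and plays the Maker–Breaker game on the reduced $k$-partite board $X$ with winning sets $\mathcal{F}$ (transversal $k$-cliques), where $n=k2^{(k+9)/2}$ is assumed; the bound is used to estimate the potential $T(\mathcal{F}_2^4)=\sum_{F\in\mathcal{F}_2^4}2^{ -|F|}$. -}

module Defs where

open import Data.Nat using (ℕ; zero; suc; _+_; _<ᵇ_)
open import Data.Bool using (Bool; true; false; _∧_; _∨_)
open import Data.Fin using (Fin; toℕ)
open import Data.Fin.Properties using (_≟_)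
open import Data.Product using (_×_; _,_; Σ-syntax)
open import Data.List using (List; []; _∷_; allFin; cartesianProduct)
open import Relation.Nullary using (¬_)
open import Relation.Nullary.Decidable using (⌊_⌋)
open import Relation.Binary.PropositionalEquality using (_≡_)

-- Board: V(K_n) = V_1 ∪ ... ∪ V_k with |V_i| = s (= n/k).
-- A vertex is (i , a): the a-th vertex of class V_i.
Vertex : ℕ → ℕ → Set
Vertex k s = Fin k × Fin s

allVertices : (k s : ℕ) → List (Vertex k s)
allVertices k s = cartesianProduct (allFin k) (allFin s)

-- Ordered pairs of vertices; an edge {u , v} of X (classes differ) is
-- represented canonically by the pair (u , v) with class u < class v.
VPair : ℕ → ℕ → Set
VPair k s = Vertex k s × Vertex k s

allVPairs : (k s : ℕ) → List (VPair k s)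
allVPairs k s = cartesianProduct (allVertices k s) (allVertices k s)

inX : {k s : ℕ} → VPair k s → Bool
inX ((i , a) , (j , b)) = toℕ i <ᵇ toℕ j

card : {A : Set} → (A → Bool) → List A → ℕ
card P [] = 0
card P (x ∷ xs) with P x
... | true  = suc (card P xs)
... | false = card P xs

VSet : ℕ → ℕ → Set
VSet k s = Vertex k s → Bool

ESet : ℕ → ℕ → Set
ESet k s = VPair k s → Bool

vcard : {k s : ℕ} → VSet k s → ℕ
vcard {k} {s} V = card V (allVertices k s)

ecard : {k s : ℕ} → ESet k s → ℕ
ecard {k} {s} F = card (λ e → inX e ∧ F e) (allVPairs k s)

_∪ᵛ_ _∩ᵛ_ : {k s : ℕ} → VSet k s → VSet k s → VSet k s
(U ∪ᵛ W) v = U v ∨ W v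
(U ∩ᵛ W) v = U v ∧ W v

_∪ᵉ_ _∩ᵉ_ : {k s : ℕ} → ESet k s → ESet k s → ESet k s
(U ∪ᵉ W) e = U e ∨ W e
(U ∩ᵉ W) e = U e ∧ W e

-- A transversal k-clique S (|S ∩ V_i| = 1 for all i) is given by the
-- choice f i ∈ V_i of its vertex in each class.
Transversal : ℕ → ℕ → Set
Transversal k s = Fin k → Fin s

cliqueVertices : {k s : ℕ} → Transversal k s → VSet k s
cliqueVertices f (i , a) = ⌊ f i ≟ a ⌋

cliqueEdges : {k s : ℕ} → Transversal k s → ESet k s
cliqueEdges f ((i , a) , (j , b)) =
  (toℕ i <ᵇ toℕ j) ∧ (⌊ f i ≟ a ⌋ ∧ ⌊ f j ≟ b ⌋)

Differ : {k s : ℕ} → ESet k s → ESet k s → Set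
Differ F G = ¬ (∀ e → F e ≡ G e)

InCluster : (k s m₁ m₂ m₃ : ℕ) → ESet k s → Set
InCluster k s m₁ m₂ m₃ F =
  Σ[ f₁ ∈ Transversal k s ] Σ[ f₂ ∈ Transversal k s ]
  Σ[ f₃ ∈ Transversal k s ] Σ[ f₄ ∈ Transversal k s ]
  let E₁ = cliqueEdges f₁ ; E₂ = cliqueEdges f₂
      E₃ = cliqueEdges f₃ ; E₄ = cliqueEdges f₄
      V₁ = cliqueVertices f₁ ; V₂ = cliqueVertices f₂
      V₃ = cliqueVertices f₃ ; V₄ = cliqueVertices f₄
  in (Differ E₁ E₂ × Differ E₁ E₃ × Differ E₁ E₄ ×
      Differ E₂ E₃ × Differ E₂ E₄ × Differ E₃ E₄)
   × (∀ e → F e ≡ (((E₁ ∪ᵉ E₂) ∪ᵉ E₃) ∪ᵉ E₄) e)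
   × (2 Data.Nat.≤ ecard (((E₁ ∩ᵉ E₂) ∩ᵉ E₃) ∩ᵉ E₄))
   × (m₁ ≡ vcard (V₁ ∩ᵛ V₂))
   × (m₂ ≡ vcard ((V₁ ∪ᵛ V₂) ∩ᵛ V₃))
   × (m₃ ≡ vcard (((V₁ ∪ᵛ V₂) ∪ᵛ V₃) ∩ᵛ V₄))

module Submission where

-- A cluster E₁ ∪ E₂ ∪ E₃ ∪ E₄ is determined by its profile, which records for every class Vᵢ
-- the four vertices of the cliques in Vᵢ.  The overlaps m₁, m₂, m₃ and the number of classes in
-- which all four vertices coincide are tallies of per-class tests on the profile, and since the
-- four cliques share an edge pair they coincide in at least three classes.  Distinct clusters of
-- type (m₁, m₂, m₃) thus have distinct admissible profiles, which are counted by induction on the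
-- number of classes: a class is either one of the t common classes (s choices instead of s⁴), or
-- for j = 1, 2, 3 its vertex in E_{j+1} is new or one of the at most j vertices of E₁, …, E_j in
-- that class; Pascal's rule and C(n, u) + j·C(n, u − 1) ≤ C(n + j, u) close the induction.
--
-- For the edge bound, adding E_{j+1} to E₁ ∪ ⋯ ∪ E_j adds C(k, 2) edges minus the shared ones,
-- and those lie in the clique spanned by the m_j vertices of E_{j+1} on earlier cliques.

open import Defs
open import Data.Nat using (ℕ; _+_; _*_; _∸_; _^_; _≤_; _/_; NonZero)
open import Data.Nat.Divisibility using (_∣_)
open import Data.Nat.Combinatorics using (_C_)
open import Data.Product using (_×_)
open import Data.List using (List; length)
open import Data.List.Relation.Unary.All using (All)
open import Data.List.Relation.Unary.AllPairs using (AllPairs)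

open import Data.Bool.Base using (Bool; true; false; T; _∧_; _∨_)
open import Data.Bool.Properties using (T-∧; T-∨; ∧-identityʳ)
open import Data.Empty using (⊥)
open import Data.Fin.Base using (Fin; toℕ) renaming (zero to fzero; suc to fsuc)
open import Data.Fin.Properties using (_≟_)
open import Data.List.Base using ([]; _∷_; _++_; map; allFin; tabulate; cartesianProduct; cartesianProductWith)
open import Data.List.Membership.Propositional using (_∈_)
open import Data.List.Membership.Propositional.Properties using (∈-allFin; ∈-cartesianProduct⁺)
open import Data.List.Relation.Unary.All as All using (_∷_)
open import Data.List.Relation.Unary.AllPairs using (_∷_)
open import Data.List.Relation.Unary.Any as Any using (Any; here; there; _─_)
open import Data.List.Relation.Unary.Any.Properties using (cartesianProductWith⁺)
open import Data.Nat.Base using (zero; suc; z≤n; s≤s; s≤s⁻¹; _<ᵇ_; _≡ᵇ_; _≤ᵇ_)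
open import Data.Nat.Combinatorics using (nC1≡n; nCk+nC[k+1]≡[n+1]C[k+1])
open import Data.Nat.Properties hiding (_≟_)
open import Data.Nat.Tactic.RingSolver using (solve-∀)
open import Data.Product using (Σ-syntax; _,_; proj₁; proj₂)
open import Data.Sum.Base using (_⊎_; inj₁; inj₂)
open import Data.Vec.Functional using (Vector) renaming ([] to []ᵛ; _∷_ to _∷ᵛ_)
open import Function.Bundles using (Equivalence)
open import Relation.Binary.PropositionalEquality
open import Relation.Nullary.Decidable using (⌊_⌋; ⌊⌋-map′; toWitness; fromWitness)
open import Relation.Nullary.Negation using (¬_; contradiction)

private
  variable
    A B X : Set
    k s : ℕ

bit : Bool → ℕ
bit true  = 1
bit false = 0

bit-∧ : ∀ a b → bit (a ∧ b) ≡ bit a * bit b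
bit-∧ true  b = sym (+-identityʳ (bit b))
bit-∧ false b = refl

bit-∨ : ∀ a b → bit (a ∨ b) ≤ bit a + bit b
bit-∨ true  b = s≤s z≤n
bit-∨ false b = ≤-refl

bit-mono : ∀ {a b} → (T a → T b) → bit a ≤ bit b
bit-mono {false}         _   = z≤n
bit-mono {true}  {true}  _   = ≤-refl
bit-mono {true}  {false} a⇒b = contradiction (a⇒b _) λ ()

T-∧⁻ : ∀ {a b} → T (a ∧ b) → T a × T b
T-∧⁻ = Equivalence.to T-∧

T-∧⁺ : ∀ {a b} → T a → T b → T (a ∧ b)
T-∧⁺ p q = Equivalence.from T-∧ (p , q)

T-∨⁻ : ∀ {a b} → T (a ∨ b) → T a ⊎ T b
T-∨⁻ = Equivalence.to T-∨

T-∨ˡ : ∀ {a} b → T a → T (a ∨ b)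
T-∨ˡ b p = Equivalence.from T-∨ (inj₁ p)

T-∨ʳ : ∀ a {b} → T b → T (a ∨ b)
T-∨ʳ a q = Equivalence.from T-∨ (inj₂ q)

sumList : List A → (A → ℕ) → ℕ
sumList []       f = 0
sumList (x ∷ xs) f = f x + sumList xs f

sumFin : (Fin k → ℕ) → ℕ
sumFin {zero}  f = 0
sumFin {suc k} f = f fzero + sumFin (λ i → f (fsuc i))

countFin : (Fin k → Bool) → ℕ
countFin c = sumFin (λ i → bit (c i))

sumList-cong : (xs : List A) {f g : A → ℕ} → (∀ x → f x ≡ g x) → sumList xs f ≡ sumList xs g
sumList-cong []       f≗g = refl
sumList-cong (x ∷ xs) f≗g = cong₂ _+_ (f≗g x) (sumList-cong xs f≗g)

sumList-mono : (xs : List A) {f g : A → ℕ} → (∀ x → f x ≤ g x) → sumList xs f ≤ sumList xs g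
sumList-mono []       f≤g = z≤n
sumList-mono (x ∷ xs) f≤g = +-mono-≤ (f≤g x) (sumList-mono xs f≤g)

sumList-++ : (xs ys : List A) (f : A → ℕ) → sumList (xs ++ ys) f ≡ sumList xs f + sumList ys f
sumList-++ []       ys f = refl
sumList-++ (x ∷ xs) ys f = trans (cong (f x +_) (sumList-++ xs ys f)) (sym (+-assoc (f x) _ _))

sumList-map : (g : A → B) (xs : List A) (f : B → ℕ) → sumList (map g xs) f ≡ sumList xs (λ x → f (g x))
sumList-map g []       f = refl
sumList-map g (x ∷ xs) f = cong (f (g x) +_) (sumList-map g xs f)

sumList-cartesianProductWith : (h : A → B → X) (xs : List A) (ys : List B) (f : X → ℕ) →
  sumList (cartesianProductWith h xs ys) f ≡ sumList xs (λ x → sumList ys (λ y → f (h x y)))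
sumList-cartesianProductWith h []       ys f = refl
sumList-cartesianProductWith h (x ∷ xs) ys f = begin
  sumList (map (h x) ys ++ cartesianProductWith h xs ys) f
    ≡⟨ sumList-++ (map (h x) ys) _ f ⟩
  sumList (map (h x) ys) f + sumList (cartesianProductWith h xs ys) f
    ≡⟨ cong₂ _+_ (sumList-map (h x) ys f) (sumList-cartesianProductWith h xs ys f) ⟩
  sumList ys (λ y → f (h x y)) + sumList xs (λ x → sumList ys (λ y → f (h x y))) ∎
  where open ≡-Reasoning

sumList-+ : (xs : List A) (f g : A → ℕ) → sumList xs (λ x → f x + g x) ≡ sumList xs f + sumList xs g
sumList-+ []       f g = refl
sumList-+ (x ∷ xs) f g = trans (cong (f x + g x +_) (sumList-+ xs f g)) (+-+-comm (f x) (g x) _ _)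
  where
  +-+-comm : ∀ a b c d → a + b + (c + d) ≡ a + c + (b + d)
  +-+-comm = solve-∀

sumList-*ʳ : (xs : List A) (f : A → ℕ) (c : ℕ) → sumList xs (λ x → f x * c) ≡ sumList xs f * c
sumList-*ʳ []       f c = refl
sumList-*ʳ (x ∷ xs) f c = trans (cong (f x * c +_) (sumList-*ʳ xs f c)) (sym (*-distribʳ-+ c (f x) _))

sumList-tabulate : (g : Fin k → A) (f : A → ℕ) → sumList (tabulate g) f ≡ sumFin (λ i → f (g i))
sumList-tabulate {zero}  g f = refl
sumList-tabulate {suc k} g f = cong (f (g fzero) +_) (sumList-tabulate (λ i → g (fsuc i)) f)

sumList-allFin : (f : Fin k → ℕ) → sumList (allFin k) f ≡ sumFin f
sumList-allFin = sumList-tabulate (λ i → i)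

sumFin-cong : {f g : Fin k → ℕ} → (∀ i → f i ≡ g i) → sumFin f ≡ sumFin g
sumFin-cong {zero}  f≗g = refl
sumFin-cong {suc k} f≗g = cong₂ _+_ (f≗g fzero) (sumFin-cong (λ i → f≗g (fsuc i)))

sumFin-mono : {f g : Fin k → ℕ} → (∀ i → f i ≤ g i) → sumFin f ≤ sumFin g
sumFin-mono {zero}  f≤g = z≤n
sumFin-mono {suc k} f≤g = +-mono-≤ (f≤g fzero) (sumFin-mono (λ i → f≤g (fsuc i)))

sumFin-+ : (f g : Fin k → ℕ) → sumFin (λ i → f i + g i) ≡ sumFin f + sumFin g
sumFin-+ {zero}  f g = refl
sumFin-+ {suc k} f g =
  trans (cong (f fzero + g fzero +_) (sumFin-+ (λ i → f (fsuc i)) (λ i → g (fsuc i))))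
        (+-+-comm (f fzero) (g fzero) _ _)
  where
  +-+-comm : ∀ a b c d → a + b + (c + d) ≡ a + c + (b + d)
  +-+-comm = solve-∀

sumFin-*ˡ : (c : ℕ) (f : Fin k → ℕ) → sumFin (λ i → c * f i) ≡ c * sumFin f
sumFin-*ˡ {zero}  c f = sym (*-zeroʳ c)
sumFin-*ˡ {suc k} c f =
  trans (cong (c * f fzero +_) (sumFin-*ˡ c (λ i → f (fsuc i)))) (sym (*-distribˡ-+ c (f fzero) _))

sumFin-*ʳ : (c : ℕ) (f : Fin k → ℕ) → sumFin (λ i → f i * c) ≡ sumFin f * c
sumFin-*ʳ c f = trans (sumFin-cong (λ i → *-comm (f i) c)) (trans (sumFin-*ˡ c f) (*-comm c _))

sumFin-const : (c : ℕ) → sumFin {k} (λ _ → c) ≡ k * c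
sumFin-const {zero}  c = refl
sumFin-const {suc k} c = cong (c +_) (sumFin-const {k} c)

≟-suc : (x a : Fin s) → ⌊ fsuc x ≟ fsuc a ⌋ ≡ ⌊ x ≟ a ⌋
≟-suc x a = ⌊⌋-map′ _ _ (x ≟ a)

sumFin-δ : (x : Fin s) (g : Fin s → ℕ) → sumFin (λ a → bit ⌊ x ≟ a ⌋ * g a) ≡ g x
sumFin-δ {suc s} fzero g = trans (cong₂ _+_ (*-identityˡ (g fzero)) (trans (sumFin-const {s} 0) (*-zeroʳ s))) (+-identityʳ (g fzero))
sumFin-δ {suc s} (fsuc x) g =
  trans (sumFin-cong (λ a → cong (λ b → bit b * g (fsuc a)) (≟-suc x a))) (sumFin-δ x (λ a → g (fsuc a)))

countFin-δ : (x : Fin s) → countFin (λ a → ⌊ x ≟ a ⌋) ≡ 1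
countFin-δ {s} x = trans (sumFin-cong {s} (λ a → sym (*-identityʳ (bit ⌊ x ≟ a ⌋)))) (sumFin-δ x (λ _ → 1))

countFin-∨ : (p q : Fin k → Bool) → countFin (λ a → p a ∨ q a) ≤ countFin p + countFin q
countFin-∨ {k} p q = ≤-trans (sumFin-mono (λ a → bit-∨ (p a) (q a))) (≤-reflexive (sumFin-+ {k} _ _))

card≡sumList : (P : A → Bool) (xs : List A) → card P xs ≡ sumList xs (λ x → bit (P x))
card≡sumList P []       = refl
card≡sumList P (x ∷ xs) with P x
... | true  = cong suc (card≡sumList P xs)
... | false = card≡sumList P xs

card-mono : (P Q : A → Bool) (xs : List A) → (∀ x → T (P x) → T (Q x)) → card P xs ≤ card Q xs
card-mono P Q xs P⇒Q = subst₂ _≤_ (sym (card≡sumList P xs)) (sym (card≡sumList Q xs))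
  (sumList-mono xs (λ x → bit-mono (P⇒Q x)))

card-cong : (P Q : A → Bool) (xs : List A) → (∀ x → P x ≡ Q x) → card P xs ≡ card Q xs
card-cong P Q xs P≗Q = trans (card≡sumList P xs)
  (trans (sumList-cong xs (λ x → cong bit (P≗Q x))) (sym (card≡sumList Q xs)))

card-none : (P : A → Bool) (xs : List A) → (∀ x → ¬ T (P x)) → card P xs ≡ 0
card-none P []       _  = refl
card-none P (x ∷ xs) ¬P with P x | ¬P x
... | true  | ¬Px = contradiction _ ¬Px
... | false | _   = card-none P xs ¬P

C-monoˡ : ∀ j n u → n C u ≤ (j + n) C u
C-monoˡ zero    n u       = ≤-refl
C-monoˡ (suc j) n zero    = ≤-refl
C-monoˡ (suc j) n (suc u) = begin
  n C suc u                       ≤⟨ C-monoˡ j n (suc u) ⟩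
  (j + n) C suc u                 ≤⟨ m≤n+m _ ((j + n) C u) ⟩
  (j + n) C u + (j + n) C suc u   ≡⟨ nCk+nC[k+1]≡[n+1]C[k+1] (j + n) u ⟩
  suc (j + n) C suc u             ∎
  where open ≤-Reasoning

choosePred : ℕ → ℕ → ℕ
choosePred n zero    = 0
choosePred n (suc u) = n C u

C-+-bound : ∀ j n u → n C u + j * choosePred n u ≤ (j + n) C u
C-+-bound j       n zero    = ≤-reflexive (cong suc (*-zeroʳ j))
C-+-bound zero    n (suc u) = ≤-reflexive (+-identityʳ (n C suc u))
C-+-bound (suc j) n (suc u) = begin
  n C suc u + (n C u + j * (n C u))   ≡⟨ swap (n C suc u) (n C u) (j * (n C u)) ⟩
  (n C suc u + j * (n C u)) + n C u   ≤⟨ +-mono-≤ (C-+-bound j n (suc u)) (C-monoˡ j n u) ⟩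
  (j + n) C suc u + (j + n) C u     ≡⟨ +-comm ((j + n) C suc u) _ ⟩
  (j + n) C u + (j + n) C suc u     ≡⟨ nCk+nC[k+1]≡[n+1]C[k+1] (j + n) u ⟩
  suc (j + n) C suc u               ∎
  where
  open ≤-Reasoning
  swap : ∀ a b c → a + (b + c) ≡ (a + c) + b
  swap = solve-∀

2≤nC2⇒3≤n : ∀ n → 2 ≤ n C 2 → 3 ≤ n
2≤nC2⇒3≤n 0 ()
2≤nC2⇒3≤n 1 ()
2≤nC2⇒3≤n 2 (s≤s ())
2≤nC2⇒3≤n (suc (suc (suc n))) _ = s≤s (s≤s (s≤s z≤n))

vanishing : ∀ {a b c} → a ≡ 0 → a * b ≤ c
vanishing refl = z≤n

-- Edge counts of cliques

sumList-allVertices : (F : Vertex k s → ℕ) →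
  sumList (allVertices k s) F ≡ sumFin (λ i → sumFin (λ a → F (i , a)))
sumList-allVertices {k} {s} F =
  trans (sumList-cartesianProductWith _,_ (allFin k) (allFin s) F)
  (trans (sumList-cong (allFin k) (λ i → sumList-allFin {s} (λ a → F (i , a)))) (sumList-allFin {k} _))

vcard≡sumFin : (U : VSet k s) → vcard U ≡ sumFin (λ i → sumFin (λ a → bit (U (i , a))))
vcard≡sumFin {k} {s} U = trans (card≡sumList U (allVertices k s)) (sumList-allVertices (λ v → bit (U v)))

ecard≡sumFin : (F : ESet k s) → ecard F ≡
  sumFin (λ i → sumFin (λ a → sumFin (λ j → sumFin (λ b →
    bit (inX ((i , a) , (j , b)) ∧ F ((i , a) , (j , b)))))))
ecard≡sumFin {k} {s} F =
  trans (card≡sumList _ (allVPairs k s))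
  (trans (sumList-cartesianProductWith _,_ (allVertices k s) (allVertices k s) _)
  (trans (sumList-cong (allVertices k s) (λ u → sumList-allVertices {k} {s} _)) (sumList-allVertices {k} {s} _)))

vcard-∩-cliqueVertices : (U : VSet k s) (f : Transversal k s) →
  vcard (U ∩ᵛ cliqueVertices f) ≡ countFin (λ i → U (i , f i))
vcard-∩-cliqueVertices U f = trans (vcard≡sumFin (U ∩ᵛ cliqueVertices f)) (sumFin-cong λ i →
  trans (sumFin-cong (λ a → trans (bit-∧ (U (i , a)) _) (*-comm (bit (U (i , a))) _)))
        (sumFin-δ (f i) (λ a → bit (U (i , a)))))

pairCount : (Fin k → Bool) → ℕ
pairCount c = sumFin (λ i → sumFin (λ j → bit ((toℕ i <ᵇ toℕ j) ∧ (c i ∧ c j))))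

pairCount≡C2 : (c : Fin k → Bool) → pairCount c ≡ countFin c C 2
pairCount≡C2 {zero}  c = refl
pairCount≡C2 {suc k} c = begin
  sumFin (λ j → bit (c fzero ∧ c (fsuc j))) + pairCount (λ i → c (fsuc i))
    ≡⟨ cong₂ _+_ (trans (sumFin-cong (λ j → bit-∧ (c fzero) (c (fsuc j)))) (sumFin-*ˡ {k} (bit (c fzero)) _))
                 (pairCount≡C2 (λ i → c (fsuc i))) ⟩
  bit (c fzero) * N + N C 2
    ≡⟨ C2-step (c fzero) ⟩
  (bit (c fzero) + N) C 2 ∎
  where
  open ≡-Reasoning
  N = countFin (λ i → c (fsuc i))
  C2-step : ∀ b → bit b * N + N C 2 ≡ (bit b + N) C 2
  C2-step false = refl
  C2-step true  = trans (cong (_+ N C 2) (trans (+-identityʳ N) (sym (nC1≡n N)))) (nCk+nC[k+1]≡[n+1]C[k+1] N 1)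

subcliqueEdges : Transversal k s → (Fin k → Bool) → ESet k s
subcliqueEdges f c e@((i , _) , (j , _)) = cliqueEdges f e ∧ (c i ∧ c j)

ecard-subcliqueEdges : (f : Transversal k s) (c : Fin k → Bool) →
  ecard (subcliqueEdges f c) ≡ countFin c C 2
ecard-subcliqueEdges {k} {s} f c =
  trans (ecard≡sumFin (subcliqueEdges f c))
  (trans (sumFin-cong (λ i → trans (sumFin-cong (λ a → row i a)) (sumFin-δ (f i) (λ _ → sumFin (K i)))))
  (pairCount≡C2 c))
  where
  K : Fin k → Fin k → ℕ
  K i j = bit ((toℕ i <ᵇ toℕ j) ∧ (c i ∧ c j))
  rearrange : ∀ l p q d → l ∧ ((l ∧ (p ∧ q)) ∧ d) ≡ p ∧ (q ∧ (l ∧ d))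
  rearrange true  true  true  d = refl
  rearrange true  true  false d = refl
  rearrange true  false q     d = refl
  rearrange false true  true  d = refl
  rearrange false true  false d = refl
  rearrange false false q     d = refl
  entry : ∀ i a j b → bit (inX ((i , a) , (j , b)) ∧ subcliqueEdges f c ((i , a) , (j , b)))
                      ≡ bit ⌊ f i ≟ a ⌋ * (bit ⌊ f j ≟ b ⌋ * K i j)
  entry i a j b = trans (cong bit (rearrange (toℕ i <ᵇ toℕ j) ⌊ f i ≟ a ⌋ ⌊ f j ≟ b ⌋ (c i ∧ c j)))
    (trans (bit-∧ ⌊ f i ≟ a ⌋ _) (cong (bit ⌊ f i ≟ a ⌋ *_) (bit-∧ ⌊ f j ≟ b ⌋ _)))
  row : ∀ i a → sumFin (λ j → sumFin (λ b → bit (inX ((i , a) , (j , b)) ∧ subcliqueEdges f c ((i , a) , (j , b)))))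
                ≡ bit ⌊ f i ≟ a ⌋ * sumFin (K i)
  row i a = trans (sumFin-cong (λ j →
      trans (sumFin-cong (entry i a j))
      (trans (sumFin-*ˡ {s} (bit ⌊ f i ≟ a ⌋) _) (cong (bit ⌊ f i ≟ a ⌋ *_) (sumFin-δ (f j) (λ _ → K i j))))))
    (sumFin-*ˡ (bit ⌊ f i ≟ a ⌋) (K i))

_⊆ᵉ_ : ESet k s → ESet k s → Set
F ⊆ᵉ G = ∀ e → T (F e) → T (G e)

ecard-mono : {F G : ESet k s} → F ⊆ᵉ G → ecard F ≤ ecard G
ecard-mono {k} {s} F⊆G = card-mono _ _ (allVPairs k s)
  (λ e p → let (x , y) = T-∧⁻ {inX e} p in T-∧⁺ x (F⊆G e y))

ecard-cong : {F G : ESet k s} → (∀ e → F e ≡ G e) → ecard F ≡ ecard G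
ecard-cong {k} {s} F≗G = card-cong _ _ (allVPairs k s) (λ e → cong (inX e ∧_) (F≗G e))

ecard-∪+∩ : (F G : ESet k s) → ecard (F ∪ᵉ G) + ecard (F ∩ᵉ G) ≡ ecard F + ecard G
ecard-∪+∩ {k} {s} F G = begin
  ecard (F ∪ᵉ G) + ecard (F ∩ᵉ G)
    ≡⟨ cong₂ _+_ (card≡sumList _ es) (card≡sumList _ es) ⟩
  sumList es (λ e → bit (inX e ∧ (F ∪ᵉ G) e)) + sumList es (λ e → bit (inX e ∧ (F ∩ᵉ G) e))
    ≡⟨ sym (sumList-+ es _ _) ⟩
  sumList es (λ e → bit (inX e ∧ (F ∪ᵉ G) e) + bit (inX e ∧ (F ∩ᵉ G) e))
    ≡⟨ sumList-cong es (λ e → bit-∪+∩ (inX e) (F e) (G e)) ⟩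
  sumList es (λ e → bit (inX e ∧ F e) + bit (inX e ∧ G e))
    ≡⟨ sumList-+ es _ _ ⟩
  sumList es (λ e → bit (inX e ∧ F e)) + sumList es (λ e → bit (inX e ∧ G e))
    ≡⟨ sym (cong₂ _+_ (card≡sumList _ es) (card≡sumList _ es)) ⟩
  ecard F + ecard G ∎
  where
  open ≡-Reasoning
  es = allVPairs k s
  bit-∪+∩ : ∀ x a b → bit (x ∧ (a ∨ b)) + bit (x ∧ (a ∧ b)) ≡ bit (x ∧ a) + bit (x ∧ b)
  bit-∪+∩ false a     b     = refl
  bit-∪+∩ true  true  true  = refl
  bit-∪+∩ true  true  false = refl
  bit-∪+∩ true  false b     = +-identityʳ (bit b)

EdgesWithin : VSet k s → ESet k s → Set
EdgesWithin U F = ∀ u v → T (F (u , v)) → T (U u) × T (U v)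

cliqueEdges-within : (f : Transversal k s) → EdgesWithin (cliqueVertices f) (cliqueEdges f)
cliqueEdges-within f (i , a) (j , b) p = T-∧⁻ (proj₂ (T-∧⁻ {toℕ i <ᵇ toℕ j} p))

within-∪ : {U W : VSet k s} {F G : ESet k s} →
  EdgesWithin U F → EdgesWithin W G → EdgesWithin (U ∪ᵛ W) (F ∪ᵉ G)
within-∪ {U = U} {W} {F} F⊆U G⊆W u v p with T-∨⁻ {F (u , v)} p
... | inj₁ q = let (x , y) = F⊆U u v q in T-∨ˡ (W u) x , T-∨ˡ (W v) y
... | inj₂ q = let (x , y) = G⊆W u v q in T-∨ʳ (U u) x , T-∨ʳ (U v) y

within-∩ : {U W : VSet k s} {F G : ESet k s} →
  EdgesWithin U F → EdgesWithin W G → EdgesWithin (U ∩ᵛ W) (F ∩ᵉ G)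
within-∩ {F = F} F⊆U G⊆W u v p =
  let (q , r) = T-∧⁻ {F (u , v)} p ; (x , y) = F⊆U u v q ; (x′ , y′) = G⊆W u v r
  in T-∧⁺ x x′ , T-∧⁺ y y′

∩-cliqueEdges⊆subcliqueEdges : {U : VSet k s} {F : ESet k s} (f : Transversal k s) →
  EdgesWithin U F → (F ∩ᵉ cliqueEdges f) ⊆ᵉ subcliqueEdges f (λ i → U (i , f i))
∩-cliqueEdges⊆subcliqueEdges {U = U} {F} f F⊆U ((i , a) , (j , b)) p =
  let (q , r) = T-∧⁻ {F ((i , a) , (j , b))} p
      (_ , fi≡a , fj≡b) = cliqueEdge-ends r
      (x , y) = F⊆U (i , a) (j , b) q
  in T-∧⁺ r (T-∧⁺ (subst (λ z → T (U (i , z))) (sym fi≡a) x) (subst (λ z → T (U (j , z))) (sym fj≡b) y))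
  where
  cliqueEdge-ends : T (cliqueEdges f ((i , a) , (j , b))) → T (toℕ i <ᵇ toℕ j) × f i ≡ a × f j ≡ b
  cliqueEdge-ends p = let (l , q) = T-∧⁻ {toℕ i <ᵇ toℕ j} p ; (x , y) = T-∧⁻ {⌊ f i ≟ a ⌋} q
                      in l , toWitness x , toWitness y

ecard-∩-cliqueEdges : {U : VSet k s} {F : ESet k s} (f : Transversal k s) →
  EdgesWithin U F → ecard (F ∩ᵉ cliqueEdges f) ≤ vcard (U ∩ᵛ cliqueVertices f) C 2
ecard-∩-cliqueEdges {U = U} {F} f F⊆U = begin
  ecard (F ∩ᵉ cliqueEdges f)                   ≤⟨ ecard-mono (∩-cliqueEdges⊆subcliqueEdges f F⊆U) ⟩
  ecard (subcliqueEdges f (λ i → U (i , f i))) ≡⟨ ecard-subcliqueEdges f _ ⟩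
  countFin (λ i → U (i , f i)) C 2             ≡⟨ cong (_C 2) (sym (vcard-∩-cliqueVertices U f)) ⟩
  vcard (U ∩ᵛ cliqueVertices f) C 2            ∎
  where open ≤-Reasoning

ecard-cliqueEdges : (f : Transversal k s) → ecard (cliqueEdges f) ≡ k C 2
ecard-cliqueEdges {k} f = begin
  ecard (cliqueEdges f)                 ≡⟨ ecard-cong (λ e → sym (∧-identityʳ (cliqueEdges f e))) ⟩
  ecard (subcliqueEdges f (λ _ → true)) ≡⟨ ecard-subcliqueEdges f _ ⟩
  countFin {k} (λ _ → true) C 2         ≡⟨ cong (_C 2) (trans (sumFin-const {k} 1) (*-identityʳ k)) ⟩
  k C 2                                 ∎
  where open ≡-Reasoning

ecard-∪-cliqueEdges : {U : VSet k s} {F : ESet k s} (f : Transversal k s) → EdgesWithin U F →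
  ecard F + k C 2 ≤ ecard (F ∪ᵉ cliqueEdges f) + vcard (U ∩ᵛ cliqueVertices f) C 2
ecard-∪-cliqueEdges {k} {U = U} {F} f F⊆U = begin
  ecard F + k C 2                                      ≡⟨ cong (ecard F +_) (sym (ecard-cliqueEdges f)) ⟩
  ecard F + ecard (cliqueEdges f)                      ≡⟨ sym (ecard-∪+∩ F (cliqueEdges f)) ⟩
  ecard (F ∪ᵉ cliqueEdges f) + ecard (F ∩ᵉ cliqueEdges f)
    ≤⟨ +-monoʳ-≤ (ecard (F ∪ᵉ cliqueEdges f)) (ecard-∩-cliqueEdges f F⊆U) ⟩
  ecard (F ∪ᵉ cliqueEdges f) + vcard (U ∩ᵛ cliqueVertices f) C 2 ∎
  where open ≤-Reasoning

telescope : ∀ K a₁ a₂ a₃ c₁ c₂ c₃ →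
  K + K ≤ a₁ + c₁ → a₁ + K ≤ a₂ + c₂ → a₂ + K ≤ a₃ + c₃ → 4 * K ≤ a₃ + c₁ + c₂ + c₃
telescope K a₁ a₂ a₃ c₁ c₂ c₃ h₁ h₂ h₃ = +-cancelˡ-≤ (a₁ + a₂) _ _ (begin
  a₁ + a₂ + 4 * K                         ≡⟨ lhs K a₁ a₂ ⟩
  (K + K) + (a₁ + K) + (a₂ + K)           ≤⟨ +-mono-≤ (+-mono-≤ h₁ h₂) h₃ ⟩
  (a₁ + c₁) + (a₂ + c₂) + (a₃ + c₃)       ≡⟨ rhs a₁ a₂ a₃ c₁ c₂ c₃ ⟩
  a₁ + a₂ + (a₃ + c₁ + c₂ + c₃)           ∎)
  where
  open ≤-Reasoning
  lhs : ∀ K a₁ a₂ → a₁ + a₂ + 4 * K ≡ (K + K) + (a₁ + K) + (a₂ + K)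
  lhs = solve-∀
  rhs : ∀ a₁ a₂ a₃ c₁ c₂ c₃ → (a₁ + c₁) + (a₂ + c₂) + (a₃ + c₃) ≡ a₁ + a₂ + (a₃ + c₁ + c₂ + c₃)
  rhs = solve-∀

module _ (f₁ f₂ f₃ f₄ : Transversal k s) where
  private
    E₁ = cliqueEdges f₁ ; E₂ = cliqueEdges f₂ ; E₃ = cliqueEdges f₃ ; E₄ = cliqueEdges f₄
    V₁ = cliqueVertices f₁ ; V₂ = cliqueVertices f₂ ; V₃ = cliqueVertices f₃ ; V₄ = cliqueVertices f₄

  ecard-∪-fourCliques :
    4 * (k C 2) ≤ ecard (((E₁ ∪ᵉ E₂) ∪ᵉ E₃) ∪ᵉ E₄) + vcard (V₁ ∩ᵛ V₂) C 2
                  + vcard ((V₁ ∪ᵛ V₂) ∩ᵛ V₃) C 2 + vcard (((V₁ ∪ᵛ V₂) ∪ᵛ V₃) ∩ᵛ V₄) C 2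
  ecard-∪-fourCliques = telescope (k C 2)
    (ecard (E₁ ∪ᵉ E₂)) (ecard ((E₁ ∪ᵉ E₂) ∪ᵉ E₃)) (ecard (((E₁ ∪ᵉ E₂) ∪ᵉ E₃) ∪ᵉ E₄))
    (vcard (V₁ ∩ᵛ V₂) C 2) (vcard ((V₁ ∪ᵛ V₂) ∩ᵛ V₃) C 2) (vcard (((V₁ ∪ᵛ V₂) ∪ᵛ V₃) ∩ᵛ V₄) C 2)
    (subst (λ n → n + k C 2 ≤ ecard (E₁ ∪ᵉ E₂) + vcard (V₁ ∩ᵛ V₂) C 2) (ecard-cliqueEdges f₁) (ecard-∪-cliqueEdges f₂ E₁⊆V₁))
    (ecard-∪-cliqueEdges f₃ E₁₂⊆V₁₂)
    (ecard-∪-cliqueEdges f₄ (within-∪ E₁₂⊆V₁₂ (cliqueEdges-within f₃)))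
    where
    E₁⊆V₁ = cliqueEdges-within f₁
    E₁₂⊆V₁₂ = within-∪ E₁⊆V₁ (cliqueEdges-within f₂)

cluster-ecard-bound : {m₁ m₂ m₃ : ℕ} {F : ESet k s} → InCluster k s m₁ m₂ m₃ F →
  4 * (k C 2) ≤ ecard F + (m₁ C 2) + (m₂ C 2) + (m₃ C 2)
cluster-ecard-bound {k} (f₁ , f₂ , f₃ , f₄ , _ , F≗E , _ , refl , refl , refl) =
  subst (λ e → 4 * (k C 2) ≤ e + _ + _ + _) (sym (ecard-cong F≗E)) (ecard-∪-fourCliques f₁ f₂ f₃ f₄)

-- Pigeonhole principle

module _ {X Y : Set} (_≉_ : X → X → Set) (Represents : X → Y → Set) (P : Y → Bool)
  (represents-injective : ∀ {x x′ y} → Represents x y → Represents x′ y → ¬ (x ≉ x′)) where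

  private
    Witness : X → Y → Set
    Witness x y = T (P y) × Represents x y

    card-─ : (ys : List Y) {x : X} (w : Any (Witness x) ys) → card P ys ≡ suc (card P (ys ─ w))
    card-─ (y ∷ ys) (here (Py , _)) with P y
    ... | true = refl
    card-─ (y ∷ ys) (there w) with P y
    ... | true  = cong suc (card-─ ys w)
    ... | false = card-─ ys w

    survives-─ : (ys : List Y) {x x′ : X} (w : Any (Witness x) ys) →
      Any (Witness x′) ys → x ≉ x′ → Any (Witness x′) (ys ─ w)
    survives-─ (y ∷ ys) (here (_ , r)) (here (_ , r′)) x≉x′ = contradiction x≉x′ (represents-injective r r′)
    survives-─ (y ∷ ys) (here _)       (there w′)      _    = w′
    survives-─ (y ∷ ys) (there w)      (here w′)       _    = here w′
    survives-─ (y ∷ ys) (there w)      (there w′)      x≉x′ = there (survives-─ ys w w′ x≉x′)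

  length≤card : (xs : List X) (ys : List Y) → AllPairs _≉_ xs →
    All (λ x → Any (Witness x) ys) xs → length xs ≤ card P ys
  length≤card []       ys _             _        = z≤n
  length≤card (x ∷ xs) ys (x≉xs ∷ ≉xs) (w ∷ ws) = subst (suc (length xs) ≤_) (sym (card-─ ys w))
    (s≤s (length≤card xs (ys ─ w) ≉xs (All.zipWith (λ (w′ , x≉x′) → survives-─ ys w w′ x≉x′) (ws , x≉xs))))

vectors : List A → (ℓ : ℕ) → List (Vector A ℓ)
vectors xs zero    = []ᵛ ∷ []
vectors xs (suc ℓ) = cartesianProductWith _∷ᵛ_ xs (vectors xs ℓ)

vectors-complete : {xs : List A} → (∀ x → x ∈ xs) → (ℓ : ℕ) (g : Vector A ℓ) →
  Any (λ h → ∀ i → h i ≡ g i) (vectors xs ℓ)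
vectors-complete x∈xs zero    g = here (λ ())
vectors-complete x∈xs (suc ℓ) g =
  cartesianProductWith⁺ _∷ᵛ_ cons-≗ (x∈xs (g fzero)) (vectors-complete x∈xs ℓ (λ i → g (fsuc i)))
  where
  cons-≗ : ∀ {y h} → g fzero ≡ y → (∀ i → h i ≡ g (fsuc i)) → ∀ i → (y ∷ᵛ h) i ≡ g i
  cons-≗ eq h≗g fzero    = sym eq
  cons-≗ eq h≗g (fsuc i) = h≗g i

-- Profiles of clusters

-- The vertices of E₁, …, E₄ in one class.
Quad : ℕ → Set
Quad s = Fin s × Fin s × Fin s × Fin s

quads : (s : ℕ) → List (Quad s)
quads s = cartesianProduct (allFin s) (cartesianProduct (allFin s) (cartesianProduct (allFin s) (allFin s)))

∈-quads : (x : Quad s) → x ∈ quads s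
∈-quads (a₁ , a₂ , a₃ , a₄) =
  ∈-cartesianProduct⁺ (∈-allFin a₁) (∈-cartesianProduct⁺ (∈-allFin a₂) (∈-cartesianProduct⁺ (∈-allFin a₃) (∈-allFin a₄)))

sumList-quads : (F : Quad s → ℕ) → sumList (quads s) F ≡
  sumFin (λ a₁ → sumFin (λ a₂ → sumFin (λ a₃ → sumFin (λ a₄ → F (a₁ , a₂ , a₃ , a₄)))))
sumList-quads {s} F =
  trans (sumList-cartesianProductWith _,_ (allFin s) _ F)
  (trans (sumList-cong (allFin s) (λ a₁ →
     trans (sumList-cartesianProductWith _,_ (allFin s) _ _)
     (trans (sumList-cong (allFin s) (λ a₂ →
        trans (sumList-cartesianProductWith _,_ (allFin s) (allFin s) _)
        (trans (sumList-cong (allFin s) (λ a₃ → sumList-allFin {s} _)) (sumList-allFin {s} _))))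
     (sumList-allFin {s} _))))
  (sumList-allFin {s} _))

overlap₁ overlap₂ overlap₃ shared : Quad s → Bool
overlap₁ (a₁ , a₂ , a₃ , a₄) = ⌊ a₁ ≟ a₂ ⌋
overlap₂ (a₁ , a₂ , a₃ , a₄) = ⌊ a₁ ≟ a₃ ⌋ ∨ ⌊ a₂ ≟ a₃ ⌋
overlap₃ (a₁ , a₂ , a₃ , a₄) = (⌊ a₁ ≟ a₄ ⌋ ∨ ⌊ a₂ ≟ a₄ ⌋) ∨ ⌊ a₃ ≟ a₄ ⌋
shared   (a₁ , a₂ , a₃ , a₄) = ⌊ a₁ ≟ a₄ ⌋ ∧ (⌊ a₁ ≟ a₃ ⌋ ∧ ⌊ a₁ ≟ a₂ ⌋)

shared⇒overlap₁ : (x : Quad s) → T (shared x) → T (overlap₁ x)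
shared⇒overlap₁ (a₁ , a₂ , a₃ , a₄) p = proj₂ (T-∧⁻ {⌊ a₁ ≟ a₃ ⌋} (proj₂ (T-∧⁻ {⌊ a₁ ≟ a₄ ⌋} p)))

shared⇒overlap₂ : (x : Quad s) → T (shared x) → T (overlap₂ x)
shared⇒overlap₂ (a₁ , a₂ , a₃ , a₄) p = T-∨ˡ ⌊ a₂ ≟ a₃ ⌋ (proj₁ (T-∧⁻ {⌊ a₁ ≟ a₃ ⌋} (proj₂ (T-∧⁻ {⌊ a₁ ≟ a₄ ⌋} p))))

shared⇒overlap₃ : (x : Quad s) → T (shared x) → T (overlap₃ x)
shared⇒overlap₃ (a₁ , a₂ , a₃ , a₄) p = T-∨ˡ ⌊ a₃ ≟ a₄ ⌋ (T-∨ˡ ⌊ a₂ ≟ a₄ ⌋ (proj₁ (T-∧⁻ {⌊ a₁ ≟ a₄ ⌋} p)))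

sumList-shared : sumList (quads s) (λ x → bit (shared x)) ≡ s
sumList-shared {s} = begin
  sumList (quads s) (λ x → bit (shared x))
    ≡⟨ sumList-quads {s} _ ⟩
  ∑ (λ a₁ → ∑ (λ a₂ → ∑ (λ a₃ → ∑ (λ a₄ → bit (shared (a₁ , a₂ , a₃ , a₄))))))
    ≡⟨ sumFin-cong {s} (λ a₁ → sumFin-cong {s} (λ a₂ → sumFin-cong {s} (λ a₃ → peel a₁ (⌊ a₁ ≟ a₃ ⌋ ∧ ⌊ a₁ ≟ a₂ ⌋)))) ⟩
  ∑ (λ a₁ → ∑ (λ a₂ → ∑ (λ a₃ → bit (⌊ a₁ ≟ a₃ ⌋ ∧ ⌊ a₁ ≟ a₂ ⌋))))
    ≡⟨ sumFin-cong {s} (λ a₁ → sumFin-cong {s} (λ a₂ → peel a₁ ⌊ a₁ ≟ a₂ ⌋)) ⟩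
  ∑ (λ a₁ → countFin (λ a₂ → ⌊ a₁ ≟ a₂ ⌋))
    ≡⟨ trans (sumFin-cong {s} countFin-δ) (trans (sumFin-const {s} 1) (*-identityʳ s)) ⟩
  s ∎
  where
  open ≡-Reasoning
  peel : (x : Fin s) (b : Bool) → sumFin (λ a → bit (⌊ x ≟ a ⌋ ∧ b)) ≡ bit b
  ∑ : (Fin s → ℕ) → ℕ
  ∑ = sumFin
  peel x b = trans (sumFin-cong (λ a → bit-∧ ⌊ x ≟ a ⌋ b)) (sumFin-δ x (λ _ → bit b))

tally : {ℓ : ℕ} → (Quad s → Bool) → Vector (Quad s) ℓ → ℕ
tally p g = countFin (λ i → p (g i))

tally-cong : {ℓ : ℕ} (p : Quad s → Bool) {g h : Vector (Quad s) ℓ} → (∀ i → g i ≡ h i) → tally p g ≡ tally p h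
tally-cong p g≗h = sumFin-cong (λ i → cong (λ x → bit (p x)) (g≗h i))

record Admissible {ℓ : ℕ} (r₁ r₂ r₃ t : ℕ) (g : Vector (Quad s) ℓ) : Set where
  field
    tally₁ : tally overlap₁ g ≡ r₁
    tally₂ : tally overlap₂ g ≡ r₂
    tally₃ : tally overlap₃ g ≡ r₃
    common : t ≤ tally shared g

admissible : {ℓ : ℕ} (r₁ r₂ r₃ t : ℕ) → Vector (Quad s) ℓ → Bool
admissible r₁ r₂ r₃ t g =
  (tally overlap₁ g ≡ᵇ r₁) ∧ ((tally overlap₂ g ≡ᵇ r₂) ∧ ((tally overlap₃ g ≡ᵇ r₃) ∧ (t ≤ᵇ tally shared g)))

admissible⁻ : {ℓ : ℕ} (r₁ r₂ r₃ t : ℕ) (g : Vector (Quad s) ℓ) →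
  T (admissible r₁ r₂ r₃ t g) → Admissible r₁ r₂ r₃ t g
admissible⁻ r₁ r₂ r₃ t g p =
  let (e₁ , p′) = T-∧⁻ {tally overlap₁ g ≡ᵇ r₁} p
      (e₂ , p″) = T-∧⁻ {tally overlap₂ g ≡ᵇ r₂} p′
      (e₃ , c)  = T-∧⁻ {tally overlap₃ g ≡ᵇ r₃} p″
  in record { tally₁ = ≡ᵇ⇒≡ _ _ e₁ ; tally₂ = ≡ᵇ⇒≡ _ _ e₂ ; tally₃ = ≡ᵇ⇒≡ _ _ e₃ ; common = ≤ᵇ⇒≤ t _ c }

admissible⁺ : {ℓ : ℕ} (r₁ r₂ r₃ t : ℕ) (g : Vector (Quad s) ℓ) →
  Admissible r₁ r₂ r₃ t g → T (admissible r₁ r₂ r₃ t g)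
admissible⁺ _ _ _ _ _ a = T-∧⁺ (≡⇒≡ᵇ _ _ tally₁) (T-∧⁺ (≡⇒≡ᵇ _ _ tally₂) (T-∧⁺ (≡⇒≡ᵇ _ _ tally₃) (≤⇒≤ᵇ common)))
  where open Admissible a

Admissible-cong : {ℓ : ℕ} {r₁ r₂ r₃ t : ℕ} {g h : Vector (Quad s) ℓ} →
  (∀ i → g i ≡ h i) → Admissible r₁ r₂ r₃ t g → Admissible r₁ r₂ r₃ t h
Admissible-cong g≗h a = record
  { tally₁ = trans (sym (tally-cong overlap₁ g≗h)) tally₁
  ; tally₂ = trans (sym (tally-cong overlap₂ g≗h)) tally₂
  ; tally₃ = trans (sym (tally-cong overlap₃ g≗h)) tally₃
  ; common = ≤-trans common (≤-reflexive (tally-cong shared g≗h))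
  }
  where open Admissible a

#admissible : (s ℓ r₁ r₂ r₃ t : ℕ) → ℕ
#admissible s ℓ r₁ r₂ r₃ t = card (admissible r₁ r₂ r₃ t) (vectors (quads s) ℓ)

cliqueUnion : Vector (Quad s) k → ESet k s
cliqueUnion g =
  ((cliqueEdges (λ i → proj₁ (g i)) ∪ᵉ cliqueEdges (λ i → proj₁ (proj₂ (g i))))
    ∪ᵉ cliqueEdges (λ i → proj₁ (proj₂ (proj₂ (g i)))))
    ∪ᵉ cliqueEdges (λ i → proj₂ (proj₂ (proj₂ (g i))))

cliqueUnion-cong : {g h : Vector (Quad s) k} → (∀ i → g i ≡ h i) → ∀ e → cliqueUnion g e ≡ cliqueUnion h e
cliqueUnion-cong g≗h ((i , a) , (j , b)) = cong₂ edgeIn (g≗h i) (g≗h j)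
  where
  edge : Fin _ → Fin _ → Bool
  edge x y = (toℕ i <ᵇ toℕ j) ∧ (⌊ x ≟ a ⌋ ∧ ⌊ y ≟ b ⌋)
  edgeIn : Quad _ → Quad _ → Bool
  edgeIn (x₁ , x₂ , x₃ , x₄) (y₁ , y₂ , y₃ , y₄) = ((edge x₁ y₁ ∨ edge x₂ y₂) ∨ edge x₃ y₃) ∨ edge x₄ y₄

module _ {m₁ m₂ m₃ : ℕ} {F : ESet k s} where

  cluster-profile : InCluster k s m₁ m₂ m₃ F →
    Σ[ g ∈ Vector (Quad s) k ] (∀ e → F e ≡ cliqueUnion g e) × Admissible m₁ m₂ m₃ 3 g
  cluster-profile (f₁ , f₂ , f₃ , f₄ , _ , F≗E , 2≤common , m₁≡ , m₂≡ , m₃≡) = g , F≗E , record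
    { tally₁ = sym (trans m₁≡ (vcard-∩-cliqueVertices V₁ f₂))
    ; tally₂ = sym (trans m₂≡ (vcard-∩-cliqueVertices (V₁ ∪ᵛ V₂) f₃))
    ; tally₃ = sym (trans m₃≡ (vcard-∩-cliqueVertices ((V₁ ∪ᵛ V₂) ∪ᵛ V₃) f₄))
    ; common = ≤-trans (2≤nC2⇒3≤n _ (≤-trans 2≤common (ecard-∩-cliqueEdges f₄ E₁₂₃⊆V₁₂₃))) (begin
        vcard (((V₁ ∩ᵛ V₂) ∩ᵛ V₃) ∩ᵛ V₄)                   ≡⟨ vcard-∩-cliqueVertices _ f₄ ⟩
        countFin (λ i → ((V₁ ∩ᵛ V₂) ∩ᵛ V₃) (i , f₄ i))     ≤⟨ sumFin-mono (λ i → bit-mono (common⇒shared i)) ⟩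
        tally shared g                                      ∎)
    }
    where
    open ≤-Reasoning
    V₁ = cliqueVertices f₁ ; V₂ = cliqueVertices f₂ ; V₃ = cliqueVertices f₃ ; V₄ = cliqueVertices f₄
    g : Vector (Quad s) k
    g i = f₁ i , f₂ i , f₃ i , f₄ i
    E₁₂₃⊆V₁₂₃ = within-∩ (within-∩ (cliqueEdges-within f₁) (cliqueEdges-within f₂)) (cliqueEdges-within f₃)
    common⇒shared : ∀ i → T (((V₁ ∩ᵛ V₂) ∩ᵛ V₃) (i , f₄ i)) → T (shared (g i))
    common⇒shared i p =
      let (p₁₂ , p₃) = T-∧⁻ {(V₁ ∩ᵛ V₂) (i , f₄ i)} p
          (p₁ , p₂) = T-∧⁻ {V₁ (i , f₄ i)} p₁₂
          1≡4 = toWitness p₁ ; 2≡4 = toWitness p₂ ; 3≡4 = toWitness p₃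
      in T-∧⁺ {⌊ f₁ i ≟ f₄ i ⌋} p₁ (T-∧⁺ {⌊ f₁ i ≟ f₃ i ⌋} (fromWitness (trans 1≡4 (sym 3≡4)))
                                                     (fromWitness (trans 1≡4 (sym 2≡4))))

length≤#admissible : (m₁ m₂ m₃ : ℕ) (L : List (ESet k s)) → AllPairs Differ L →
  All (InCluster k s m₁ m₂ m₃) L → length L ≤ #admissible s k m₁ m₂ m₃ 3
length≤#admissible {k} {s} m₁ m₂ m₃ L distinct clusters =
  length≤card Differ Represents (admissible m₁ m₂ m₃ 3)
    (λ r r′ F≉F′ → F≉F′ (λ e → trans (r e) (sym (r′ e))))
    L (vectors (quads s) k) distinct (All.map witness clusters)
  where
  Represents : ESet k s → Vector (Quad s) k → Set
  Represents F g = ∀ e → F e ≡ cliqueUnion g e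
  witness : ∀ {F} → InCluster k s m₁ m₂ m₃ F →
    Any (λ h → T (admissible m₁ m₂ m₃ 3 h) × Represents F h) (vectors (quads s) k)
  witness c with cluster-profile c
  ... | g , F≗g , adm = Any.map (λ {h} h≗g → admissible⁺ m₁ m₂ m₃ 3 h (Admissible-cong (λ i → sym (h≗g i)) adm) ,
                                          (λ e → trans (F≗g e) (sym (cliqueUnion-cong h≗g e))))
                                (vectors-complete ∈-quads k g)

-- Counting admissible profiles

module Counting (s : ℕ) where

  binomials : (ℓ u₁ u₂ u₃ : ℕ) → ℕ
  binomials ℓ u₁ u₂ u₃ = (ℓ C u₁) * (((2 * ℓ) C u₂) * ((3 * ℓ) C u₃))

  bound : (ℓ t u₁ u₂ u₃ : ℕ) → ℕ
  bound ℓ t u₁ u₂ u₃ = (ℓ C t) * binomials ℓ u₁ u₂ u₃ * s ^ (4 * ℓ)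

  CountBound : (ℓ t : ℕ) → Set
  CountBound ℓ t = ∀ u₁ u₂ u₃ →
    #admissible s ℓ (t + u₁) (t + u₂) (t + u₃) t * s ^ ((t + u₁) + (t + u₂) + (t + u₃)) ≤ bound ℓ t u₁ u₂ u₃

  extensions : (ℓ r₁ r₂ r₃ t : ℕ) → Quad s → ℕ
  extensions ℓ r₁ r₂ r₃ t x = card (λ g → admissible r₁ r₂ r₃ t (x ∷ᵛ g)) (vectors (quads s) ℓ)

  #admissible-suc : ∀ ℓ r₁ r₂ r₃ t →
    #admissible s (suc ℓ) r₁ r₂ r₃ t ≡ sumList (quads s) (extensions ℓ r₁ r₂ r₃ t)
  #admissible-suc ℓ r₁ r₂ r₃ t =
    trans (card≡sumList _ (vectors (quads s) (suc ℓ)))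
    (trans (sumList-cartesianProductWith _∷ᵛ_ (quads s) (vectors (quads s) ℓ) _)
           (sumList-cong (quads s) (λ x → sym (card≡sumList _ (vectors (quads s) ℓ)))))

  Unshared : Quad s → ℕ → Set
  Unshared x t = shared x ≡ false ⊎ t ≡ 0

  unshared-common : ∀ {x t c} → Unshared x t → t ≤ bit (shared x) + c → t ≤ c
  unshared-common {x} (inj₁ unshared) t≤ = subst (λ b → _ ≤ bit b + _) unshared t≤
  unshared-common     (inj₂ refl)     _  = z≤n

  extensions-shared : ∀ ℓ t u₁ u₂ u₃ x → T (shared x) →
    extensions ℓ (suc t + u₁) (suc t + u₂) (suc t + u₃) (suc t) x ≤ #admissible s ℓ (t + u₁) (t + u₂) (t + u₃) t
  extensions-shared ℓ t u₁ u₂ u₃ x sh = card-mono _ _ (vectors (quads s) ℓ) (λ g p →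
    let open Admissible (admissible⁻ (suc t + u₁) (suc t + u₂) (suc t + u₃) (suc t) (x ∷ᵛ g) p)
    in admissible⁺ (t + u₁) (t + u₂) (t + u₃) t g (record
      { tally₁ = drop (shared⇒overlap₁ x sh) tally₁
      ; tally₂ = drop (shared⇒overlap₂ x sh) tally₂
      ; tally₃ = drop (shared⇒overlap₃ x sh) tally₃
      ; common = drop-≤ sh common
      }))
    where
    drop : ∀ {b c r} → T b → bit b + c ≡ suc r → c ≡ r
    drop {true} _ = suc-injective
    drop-≤ : ∀ {b c r} → T b → suc r ≤ bit b + c → r ≤ c
    drop-≤ {true} _ = s≤s⁻¹

  extensions-unshared : ∀ ℓ t {u₁ u₂ u₃} v₁ v₂ v₃ x → Unshared x t →
    u₁ ≡ bit (overlap₁ x) + v₁ → u₂ ≡ bit (overlap₂ x) + v₂ → u₃ ≡ bit (overlap₃ x) + v₃ →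
    extensions ℓ (t + u₁) (t + u₂) (t + u₃) t x ≤ #admissible s ℓ (t + v₁) (t + v₂) (t + v₃) t
  extensions-unshared ℓ t {u₁} {u₂} {u₃} v₁ v₂ v₃ x un refl refl refl =
    card-mono _ _ (vectors (quads s) ℓ) (λ g p →
    let open Admissible (admissible⁻ (t + u₁) (t + u₂) (t + u₃) t (x ∷ᵛ g) p)
    in admissible⁺ (t + v₁) (t + v₂) (t + v₃) t g (record
      { tally₁ = drop (bit (overlap₁ x)) (tally overlap₁ g) tally₁
      ; tally₂ = drop (bit (overlap₂ x)) (tally overlap₂ g) tally₂
      ; tally₃ = drop (bit (overlap₃ x)) (tally overlap₃ g) tally₃
      ; common = unshared-common {x} un common
      }))
    where
    drop : ∀ b c {v} → b + c ≡ t + (b + v) → c ≡ t + v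
    drop b c {v} e = +-cancelˡ-≡ b c (t + v) (trans e (+-comm-middle t b v))
      where
      +-comm-middle : ∀ t b v → t + (b + v) ≡ b + (t + v)
      +-comm-middle = solve-∀

  -- A common class counts towards every overlap tally, so an overlap tally cannot be exhausted
  -- while common classes remain.
  ¬blocked : ∀ {ℓ t} (o : Quad s → Bool) → (∀ x → T (shared x) → T (o x)) →
    ∀ x (g : Vector (Quad s) ℓ) → Unshared x t → T (o x) →
    tally o (x ∷ᵛ g) ≡ t + 0 → t ≤ tally shared (x ∷ᵛ g) → ⊥
  ¬blocked {t = t} o shared⇒o x g un ox tallyₒ≡t t≤common with o x | un
  ... | true | inj₂ refl = contradiction tallyₒ≡t λ ()
  ... | true | inj₁ unshared = <-irrefl refl (begin-strict
    t                    ≤⟨ unshared-common {x} (inj₁ unshared) t≤common ⟩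
    tally shared g       ≤⟨ sumFin-mono (λ i → bit-mono (shared⇒o (g i))) ⟩
    tally o g            <⟨ n<1+n _ ⟩
    suc (tally o g)      ≡⟨ trans tallyₒ≡t (+-identityʳ t) ⟩
    t                    ∎)
    where open ≤-Reasoning

  weight : ℕ → ℕ → Bool → ℕ
  weight n u false = n C u
  weight n u true  = s * choosePred n u

  weights : (ℓ u₁ u₂ u₃ : ℕ) → Quad s → ℕ
  weights ℓ u₁ u₂ u₃ x =
    weight ℓ u₁ (overlap₁ x) * (weight (2 * ℓ) u₂ (overlap₂ x) * weight (3 * ℓ) u₃ (overlap₃ x))

  weight-split : ∀ b u → (b ≡ true × u ≡ 0) ⊎
    Σ[ v ∈ ℕ ] (u ≡ bit b + v × ∀ n → weight n u b ≡ s ^ bit b * (n C v))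
  weight-split false u       = inj₂ (u , refl , λ n → sym (+-identityʳ (n C u)))
  weight-split true  zero    = inj₁ (refl , refl)
  weight-split true  (suc v) = inj₂ (v , refl , λ n → cong (_* (n C v)) (sym (*-identityʳ s)))

  s^-split : ∀ t a₁ a₂ a₃ v₁ v₂ v₃ {u₁ u₂ u₃} → u₁ ≡ a₁ + v₁ → u₂ ≡ a₂ + v₂ → u₃ ≡ a₃ + v₃ →
    s ^ ((t + u₁) + (t + u₂) + (t + u₃)) ≡ s ^ a₁ * (s ^ a₂ * (s ^ a₃ * s ^ ((t + v₁) + (t + v₂) + (t + v₃))))
  s^-split t a₁ a₂ a₃ v₁ v₂ v₃ refl refl refl =
    trans (cong (s ^_) (exponents t a₁ a₂ a₃ v₁ v₂ v₃))
    (trans (^-distribˡ-+-* s a₁ _) (cong (s ^ a₁ *_) (trans (^-distribˡ-+-* s a₂ _) (cong (s ^ a₂ *_) (^-distribˡ-+-* s a₃ _)))))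
    where
    exponents : ∀ t a b c v₁ v₂ v₃ →
      (t + (a + v₁)) + (t + (b + v₂)) + (t + (c + v₃)) ≡ a + (b + (c + ((t + v₁) + (t + v₂) + (t + v₃))))
    exponents = solve-∀

  extensions-vanish : ∀ ℓ r₁ r₂ r₃ t x → (∀ g → ¬ Admissible r₁ r₂ r₃ t (x ∷ᵛ g)) →
    extensions ℓ r₁ r₂ r₃ t x ≡ 0
  extensions-vanish ℓ r₁ r₂ r₃ t x ¬adm =
    card-none _ (vectors (quads s) ℓ) (λ g p → ¬adm g (admissible⁻ r₁ r₂ r₃ t (x ∷ᵛ g) p))

  extensions-unshared-bound : ∀ ℓ t u₁ u₂ u₃ x → Unshared x t → CountBound ℓ t →
    extensions ℓ (t + u₁) (t + u₂) (t + u₃) t x * s ^ ((t + u₁) + (t + u₂) + (t + u₃))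
      ≤ weights ℓ u₁ u₂ u₃ x * ((ℓ C t) * s ^ (4 * ℓ))
  extensions-unshared-bound ℓ t u₁ u₂ u₃ x un IH
    with weight-split (overlap₁ x) u₁ | weight-split (overlap₂ x) u₂ | weight-split (overlap₃ x) u₃
  ... | inj₁ (o , refl) | _ | _ = vanishing (extensions-vanish ℓ _ _ _ t x (λ g a →
          ¬blocked overlap₁ shared⇒overlap₁ x g un (subst T (sym o) _) (Admissible.tally₁ a) (Admissible.common a)))
  ... | inj₂ _ | inj₁ (o , refl) | _ = vanishing (extensions-vanish ℓ _ _ _ t x (λ g a →
          ¬blocked overlap₂ shared⇒overlap₂ x g un (subst T (sym o) _) (Admissible.tally₂ a) (Admissible.common a)))
  ... | inj₂ _ | inj₂ _ | inj₁ (o , refl) = vanishing (extensions-vanish ℓ _ _ _ t x (λ g a →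
          ¬blocked overlap₃ shared⇒overlap₃ x g un (subst T (sym o) _) (Admissible.tally₃ a) (Admissible.common a)))
  ... | inj₂ (v₁ , u₁≡ , w₁) | inj₂ (v₂ , u₂≡ , w₂) | inj₂ (v₃ , u₃≡ , w₃) = begin
    extensions ℓ (t + u₁) (t + u₂) (t + u₃) t x * s ^ E u₁ u₂ u₃
      ≤⟨ *-monoˡ-≤ (s ^ E u₁ u₂ u₃) (extensions-unshared ℓ t v₁ v₂ v₃ x un u₁≡ u₂≡ u₃≡) ⟩
    N * s ^ E u₁ u₂ u₃
      ≡⟨ cong (N *_) (s^-split t b₁ b₂ b₃ v₁ v₂ v₃ u₁≡ u₂≡ u₃≡) ⟩
    N * (S₁ * (S₂ * (S₃ * s ^ E v₁ v₂ v₃)))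
      ≡⟨ regroup N S₁ S₂ S₃ (s ^ E v₁ v₂ v₃) ⟩
    (S₁ * (S₂ * S₃)) * (N * s ^ E v₁ v₂ v₃)
      ≤⟨ *-monoʳ-≤ (S₁ * (S₂ * S₃)) (IH v₁ v₂ v₃) ⟩
    (S₁ * (S₂ * S₃)) * bound ℓ t v₁ v₂ v₃
      ≡⟨ distribute S₁ S₂ S₃ (ℓ C t) (ℓ C v₁) ((2 * ℓ) C v₂) ((3 * ℓ) C v₃) (s ^ (4 * ℓ)) ⟩
    (S₁ * (ℓ C v₁)) * ((S₂ * ((2 * ℓ) C v₂)) * (S₃ * ((3 * ℓ) C v₃))) * ((ℓ C t) * s ^ (4 * ℓ))
      ≡⟨ cong (_* ((ℓ C t) * s ^ (4 * ℓ))) (sym (cong₂ _*_ (w₁ ℓ) (cong₂ _*_ (w₂ (2 * ℓ)) (w₃ (3 * ℓ))))) ⟩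
    weights ℓ u₁ u₂ u₃ x * ((ℓ C t) * s ^ (4 * ℓ)) ∎
    where
    open ≤-Reasoning
    E : ℕ → ℕ → ℕ → ℕ
    E u₁ u₂ u₃ = (t + u₁) + (t + u₂) + (t + u₃)
    N = #admissible s ℓ (t + v₁) (t + v₂) (t + v₃) t
    b₁ = bit (overlap₁ x) ; b₂ = bit (overlap₂ x) ; b₃ = bit (overlap₃ x)
    S₁ = s ^ b₁ ; S₂ = s ^ b₂ ; S₃ = s ^ b₃
    regroup : ∀ n a b c e → n * (a * (b * (c * e))) ≡ (a * (b * c)) * (n * e)
    regroup = solve-∀
    distribute : ∀ a b c d x y z e → (a * (b * c)) * (d * (x * (y * z)) * e) ≡ ((a * x) * ((b * y) * (c * z))) * (d * e)
    distribute = solve-∀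

  extensions-shared-bound : ∀ ℓ t u₁ u₂ u₃ x → T (shared x) → CountBound ℓ t →
    extensions ℓ (suc t + u₁) (suc t + u₂) (suc t + u₃) (suc t) x
      * s ^ ((suc t + u₁) + (suc t + u₂) + (suc t + u₃))
      ≤ s ^ 3 * bound ℓ t u₁ u₂ u₃
  extensions-shared-bound ℓ t u₁ u₂ u₃ x sh IH = begin
    extensions ℓ (suc t + u₁) (suc t + u₂) (suc t + u₃) (suc t) x * s ^ E′
      ≤⟨ *-monoˡ-≤ (s ^ E′) (extensions-shared ℓ t u₁ u₂ u₃ x sh) ⟩
    N * s ^ E′
      ≡⟨ cong (N *_) (trans (cong (s ^_) (exponents t u₁ u₂ u₃)) (^-distribˡ-+-* s 3 E)) ⟩
    N * (s ^ 3 * s ^ E)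
      ≡⟨ swap N (s ^ 3) (s ^ E) ⟩
    s ^ 3 * (N * s ^ E)
      ≤⟨ *-monoʳ-≤ (s ^ 3) (IH u₁ u₂ u₃) ⟩
    s ^ 3 * bound ℓ t u₁ u₂ u₃ ∎
    where
    open ≤-Reasoning
    N = #admissible s ℓ (t + u₁) (t + u₂) (t + u₃) t
    E = (t + u₁) + (t + u₂) + (t + u₃)
    E′ = (suc t + u₁) + (suc t + u₂) + (suc t + u₃)
    exponents : ∀ t u₁ u₂ u₃ → (suc t + u₁) + (suc t + u₂) + (suc t + u₃) ≡ 3 + ((t + u₁) + (t + u₂) + (t + u₃))
    exponents = solve-∀
    swap : ∀ a b c → a * (b * c) ≡ b * (a * c)
    swap = solve-∀

  weight≤ : ∀ n u b → weight n u b ≤ n C u + bit b * (s * choosePred n u)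
  weight≤ n u false = m≤m+n (n C u) 0
  weight≤ n u true  = ≤-trans (m≤n+m _ (n C u)) (+-monoʳ-≤ (n C u) (≤-reflexive (sym (+-identityʳ _))))

  sumFin-weight : ∀ {c} (p : Fin s → Bool) n u → countFin p ≤ c →
    sumFin (λ a → weight n u (p a)) ≤ s * ((c + n) C u)
  sumFin-weight {c} p n u #p≤c = begin
    sumFin (λ a → weight n u (p a))
      ≤⟨ sumFin-mono (λ a → weight≤ n u (p a)) ⟩
    sumFin (λ a → n C u + bit (p a) * (s * choosePred n u))
      ≡⟨ sumFin-+ {s} (λ _ → n C u) _ ⟩
    sumFin {s} (λ _ → n C u) + sumFin (λ a → bit (p a) * (s * choosePred n u))
      ≡⟨ cong₂ _+_ (sumFin-const {s} (n C u)) (sumFin-*ʳ (s * choosePred n u) (λ a → bit (p a))) ⟩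
    s * (n C u) + countFin p * (s * choosePred n u)
      ≤⟨ +-monoʳ-≤ (s * (n C u)) (*-monoˡ-≤ (s * choosePred n u) #p≤c) ⟩
    s * (n C u) + c * (s * choosePred n u)
      ≡⟨ factor s (n C u) c (choosePred n u) ⟩
    s * ((n C u) + c * choosePred n u)
      ≤⟨ *-monoʳ-≤ s (C-+-bound c n u) ⟩
    s * ((c + n) C u) ∎
    where
    open ≤-Reasoning
    factor : ∀ s a c b → s * a + c * (s * b) ≡ s * (a + c * b)
    factor = solve-∀

  sumList-weights : ∀ ℓ u₁ u₂ u₃ → sumList (quads s) (weights ℓ u₁ u₂ u₃) ≤ s ^ 4 * binomials (suc ℓ) u₁ u₂ u₃
  sumList-weights ℓ u₁ u₂ u₃ = begin
    sumList (quads s) (weights ℓ u₁ u₂ u₃)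
      ≡⟨ sumList-quads {s} _ ⟩
    ∑ (λ a₁ → ∑ (λ a₂ → ∑ (λ a₃ → ∑ (λ a₄ → w₁ a₁ a₂ * (w₂ a₁ a₂ a₃ * w₃ a₁ a₂ a₃ a₄)))))
      ≤⟨ sumFin-mono {s} (λ a₁ → sumFin-mono {s} (λ a₂ → sumFin-mono {s} (λ a₃ →
           scale (w₁ a₁ a₂) (scale (w₂ a₁ a₂ a₃) (sumFin-weight _ (3 * ℓ) u₃ (≤3 a₁ a₂ a₃)))))) ⟩
    ∑ (λ a₁ → ∑ (λ a₂ → ∑ (λ a₃ → w₁ a₁ a₂ * (w₂ a₁ a₂ a₃ * (s * Z₃)))))
      ≤⟨ sumFin-mono {s} (λ a₁ → sumFin-mono {s} (λ a₂ →
           scale (w₁ a₁ a₂) (scaleʳ (s * Z₃) (sumFin-weight _ (2 * ℓ) u₂ (≤2 a₁ a₂))))) ⟩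
    ∑ (λ a₁ → ∑ (λ a₂ → w₁ a₁ a₂ * ((s * Z₂) * (s * Z₃))))
      ≤⟨ sumFin-mono {s} (λ a₁ → scaleʳ ((s * Z₂) * (s * Z₃)) (sumFin-weight _ ℓ u₁ (≤-reflexive (countFin-δ a₁)))) ⟩
    ∑ (λ _ → (s * Z₁) * ((s * Z₂) * (s * Z₃)))
      ≡⟨ sumFin-const {s} _ ⟩
    s * ((s * Z₁) * ((s * Z₂) * (s * Z₃)))
      ≡⟨ collect s Z₁ Z₂ Z₃ ⟩
    s ^ 4 * (Z₁ * (Z₂ * Z₃))
      ≡⟨ cong (λ m → s ^ 4 * (Z₁ * (m * Z₃))) (cong (_C u₂) (sym (*-suc 2 ℓ))) ⟩
    s ^ 4 * (Z₁ * (((2 * suc ℓ) C u₂) * Z₃))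
      ≡⟨ cong (λ m → s ^ 4 * (Z₁ * (((2 * suc ℓ) C u₂) * m))) (cong (_C u₃) (sym (*-suc 3 ℓ))) ⟩
    s ^ 4 * binomials (suc ℓ) u₁ u₂ u₃ ∎
    where
    open ≤-Reasoning
    ∑ : (Fin s → ℕ) → ℕ
    ∑ = sumFin
    w₁ : Fin s → Fin s → ℕ
    w₁ a₁ a₂ = weight ℓ u₁ ⌊ a₁ ≟ a₂ ⌋
    w₂ : Fin s → Fin s → Fin s → ℕ
    w₂ a₁ a₂ a₃ = weight (2 * ℓ) u₂ (⌊ a₁ ≟ a₃ ⌋ ∨ ⌊ a₂ ≟ a₃ ⌋)
    w₃ : Fin s → Fin s → Fin s → Fin s → ℕ
    w₃ a₁ a₂ a₃ a₄ = weight (3 * ℓ) u₃ ((⌊ a₁ ≟ a₄ ⌋ ∨ ⌊ a₂ ≟ a₄ ⌋) ∨ ⌊ a₃ ≟ a₄ ⌋)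
    Z₁ = (1 + ℓ) C u₁ ; Z₂ = (2 + 2 * ℓ) C u₂ ; Z₃ = (3 + 3 * ℓ) C u₃
    scale : ∀ c {f : Fin s → ℕ} {b} → sumFin f ≤ b → sumFin (λ a → c * f a) ≤ c * b
    scale c {f} Σf≤b = ≤-trans (≤-reflexive (sumFin-*ˡ c f)) (*-monoʳ-≤ c Σf≤b)
    scaleʳ : ∀ c {f : Fin s → ℕ} {b} → sumFin f ≤ b → sumFin (λ a → f a * c) ≤ b * c
    scaleʳ c {f} Σf≤b = ≤-trans (≤-reflexive (sumFin-*ʳ c f)) (*-monoˡ-≤ c Σf≤b)
    ≤2 : ∀ a₁ a₂ → countFin (λ a → ⌊ a₁ ≟ a ⌋ ∨ ⌊ a₂ ≟ a ⌋) ≤ 2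
    ≤2 a₁ a₂ = ≤-trans (countFin-∨ {s} _ _) (≤-reflexive (cong₂ _+_ (countFin-δ a₁) (countFin-δ a₂)))
    ≤3 : ∀ a₁ a₂ a₃ → countFin (λ a → (⌊ a₁ ≟ a ⌋ ∨ ⌊ a₂ ≟ a ⌋) ∨ ⌊ a₃ ≟ a ⌋) ≤ 3
    ≤3 a₁ a₂ a₃ = ≤-trans (countFin-∨ {s} _ _) (+-mono-≤ (≤2 a₁ a₂) (≤-reflexive (countFin-δ a₃)))
    collect : ∀ s a b c → s * ((s * a) * ((s * b) * (s * c))) ≡ s * (s * (s * (s * 1))) * (a * (b * c))
    collect = solve-∀

  binomials-mono : ∀ ℓ u₁ u₂ u₃ → binomials ℓ u₁ u₂ u₃ ≤ binomials (suc ℓ) u₁ u₂ u₃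
  binomials-mono ℓ u₁ u₂ u₃ = *-mono-≤ (C-monoˡ 1 ℓ u₁) (*-mono-≤
    (≤-trans (C-monoˡ 2 (2 * ℓ) u₂) (≤-reflexive (cong (_C u₂) (sym (*-suc 2 ℓ)))))
    (≤-trans (C-monoˡ 3 (3 * ℓ) u₃) (≤-reflexive (cong (_C u₃) (sym (*-suc 3 ℓ))))))

  s^4[1+ℓ] : ∀ ℓ → s ^ (4 * suc ℓ) ≡ s ^ 4 * s ^ (4 * ℓ)
  s^4[1+ℓ] ℓ = trans (cong (s ^_) (*-suc 4 ℓ)) (^-distribˡ-+-* s 4 (4 * ℓ))

  extensions-bound : ∀ ℓ t u₁ u₂ u₃ x → CountBound ℓ t → CountBound ℓ (suc t) →
    extensions ℓ (suc t + u₁) (suc t + u₂) (suc t + u₃) (suc t) x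
      * s ^ ((suc t + u₁) + (suc t + u₂) + (suc t + u₃))
      ≤ bit (shared x) * (s ^ 3 * bound ℓ t u₁ u₂ u₃) + weights ℓ u₁ u₂ u₃ x * ((ℓ C suc t) * s ^ (4 * ℓ))
  extensions-bound ℓ t u₁ u₂ u₃ x IH IH′ = by-cases (shared x) refl
    where
    by-cases : ∀ b → shared x ≡ b →
      extensions ℓ (suc t + u₁) (suc t + u₂) (suc t + u₃) (suc t) x
        * s ^ ((suc t + u₁) + (suc t + u₂) + (suc t + u₃))
        ≤ bit b * (s ^ 3 * bound ℓ t u₁ u₂ u₃) + weights ℓ u₁ u₂ u₃ x * ((ℓ C suc t) * s ^ (4 * ℓ))
    by-cases true  sh = ≤-trans (extensions-shared-bound ℓ t u₁ u₂ u₃ x (subst T (sym sh) _) IH)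
                                (≤-trans (≤-reflexive (sym (*-identityˡ _))) (m≤m+n _ _))
    by-cases false sh = extensions-unshared-bound ℓ (suc t) u₁ u₂ u₃ x (inj₁ sh) IH′

  count-bound-empty : ∀ t → CountBound 0 t
  count-bound-empty zero    zero     zero     zero     = ≤-refl
  count-bound-empty zero    zero     zero     (suc u₃) = z≤n
  count-bound-empty zero    zero     (suc u₂) u₃       = z≤n
  count-bound-empty zero    (suc u₁) u₂       u₃       = z≤n
  count-bound-empty (suc t) u₁       u₂       u₃       = z≤n

  count-bound-no-common : ∀ ℓ → CountBound ℓ 0 → CountBound (suc ℓ) 0
  count-bound-no-common ℓ IH u₁ u₂ u₃ = begin
    #admissible s (suc ℓ) u₁ u₂ u₃ 0 * S
      ≡⟨ cong (_* S) (#admissible-suc ℓ u₁ u₂ u₃ 0) ⟩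
    sumList (quads s) (extensions ℓ u₁ u₂ u₃ 0) * S
      ≡⟨ sym (sumList-*ʳ (quads s) _ S) ⟩
    sumList (quads s) (λ x → extensions ℓ u₁ u₂ u₃ 0 x * S)
      ≤⟨ sumList-mono (quads s) (λ x → extensions-unshared-bound ℓ 0 u₁ u₂ u₃ x (inj₂ refl) IH) ⟩
    sumList (quads s) (λ x → weights ℓ u₁ u₂ u₃ x * (1 * s ^ (4 * ℓ)))
      ≡⟨ sumList-*ʳ (quads s) (weights ℓ u₁ u₂ u₃) _ ⟩
    sumList (quads s) (weights ℓ u₁ u₂ u₃) * (1 * s ^ (4 * ℓ))
      ≤⟨ *-monoˡ-≤ _ (sumList-weights ℓ u₁ u₂ u₃) ⟩
    (s ^ 4 * Bin) * (1 * s ^ (4 * ℓ))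
      ≡⟨ rearrange (s ^ 4) Bin (s ^ (4 * ℓ)) ⟩
    1 * Bin * (s ^ 4 * s ^ (4 * ℓ))
      ≡⟨ cong (1 * Bin *_) (sym (s^4[1+ℓ] ℓ)) ⟩
    bound (suc ℓ) 0 u₁ u₂ u₃ ∎
    where
    open ≤-Reasoning
    S = s ^ (u₁ + u₂ + u₃)
    Bin = binomials (suc ℓ) u₁ u₂ u₃
    rearrange : ∀ a b e → (a * b) * (1 * e) ≡ 1 * b * (a * e)
    rearrange = solve-∀
  count-bound-common : ∀ ℓ t → CountBound ℓ t → CountBound ℓ (suc t) → CountBound (suc ℓ) (suc t)
  count-bound-common ℓ t IH IH′ u₁ u₂ u₃ = begin
    #admissible s (suc ℓ) r₁ r₂ r₃ (suc t) * S
      ≡⟨ cong (_* S) (#admissible-suc ℓ r₁ r₂ r₃ (suc t)) ⟩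
    sumList (quads s) (extensions ℓ r₁ r₂ r₃ (suc t)) * S
      ≡⟨ sym (sumList-*ʳ (quads s) _ S) ⟩
    sumList (quads s) (λ x → extensions ℓ r₁ r₂ r₃ (suc t) x * S)
      ≤⟨ sumList-mono (quads s) (λ x → extensions-bound ℓ t u₁ u₂ u₃ x IH IH′) ⟩
    sumList (quads s) (λ x → bit (shared x) * Δ + weights ℓ u₁ u₂ u₃ x * K)
      ≡⟨ sumList-+ (quads s) _ _ ⟩
    sumList (quads s) (λ x → bit (shared x) * Δ) + sumList (quads s) (λ x → weights ℓ u₁ u₂ u₃ x * K)
      ≡⟨ cong₂ _+_ (trans (sumList-*ʳ (quads s) _ Δ) (cong (_* Δ) (sumList-shared {s})))
                   (sumList-*ʳ (quads s) (weights ℓ u₁ u₂ u₃) K) ⟩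
    s * Δ + sumList (quads s) (weights ℓ u₁ u₂ u₃) * K
      ≤⟨ +-mono-≤ (*-monoʳ-≤ s (*-monoʳ-≤ (s ^ 3) (*-monoˡ-≤ (s ^ (4 * ℓ)) (*-monoʳ-≤ (ℓ C t) (binomials-mono ℓ u₁ u₂ u₃)))))
                  (*-monoˡ-≤ K (sumList-weights ℓ u₁ u₂ u₃)) ⟩
    s * (s ^ 3 * ((ℓ C t) * Bin * s ^ (4 * ℓ))) + (s ^ 4 * Bin) * K
      ≡⟨ rearrange s (s ^ 3) (ℓ C t) (ℓ C suc t) Bin (s ^ (4 * ℓ)) ⟩
    ((ℓ C t) + (ℓ C suc t)) * Bin * (s ^ 4 * s ^ (4 * ℓ))
      ≡⟨ cong₂ (λ c e → c * Bin * e) (nCk+nC[k+1]≡[n+1]C[k+1] ℓ t) (sym (s^4[1+ℓ] ℓ)) ⟩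
    bound (suc ℓ) (suc t) u₁ u₂ u₃ ∎
    where
    open ≤-Reasoning
    r₁ = suc t + u₁ ; r₂ = suc t + u₂ ; r₃ = suc t + u₃
    S = s ^ (r₁ + r₂ + r₃)
    Δ = s ^ 3 * bound ℓ t u₁ u₂ u₃
    K = (ℓ C suc t) * s ^ (4 * ℓ)
    Bin = binomials (suc ℓ) u₁ u₂ u₃
    rearrange : ∀ s s³ c c′ b e → s * (s³ * (c * b * e)) + (s * s³ * b) * (c′ * e) ≡ (c + c′) * b * (s * s³ * e)
    rearrange = solve-∀

  count-bound : ∀ ℓ t → CountBound ℓ t
  count-bound zero    t       = count-bound-empty t
  count-bound (suc ℓ) zero    = count-bound-no-common ℓ (count-bound ℓ 0)
  count-bound (suc ℓ) (suc t) = count-bound-common ℓ t (count-bound ℓ t) (count-bound ℓ (suc t))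

  admissible-bound : ∀ ℓ t {r₁ r₂ r₃} → t ≤ r₁ → t ≤ r₂ → t ≤ r₃ →
    #admissible s ℓ r₁ r₂ r₃ t * s ^ (r₁ + r₂ + r₃) ≤ bound ℓ t (r₁ ∸ t) (r₂ ∸ t) (r₃ ∸ t)
  admissible-bound ℓ t t≤r₁ t≤r₂ t≤r₃ = go (m+[n∸m]≡n t≤r₁) (m+[n∸m]≡n t≤r₂) (m+[n∸m]≡n t≤r₃)
    where
    go : ∀ {r₁ r₂ r₃ u₁ u₂ u₃} → t + u₁ ≡ r₁ → t + u₂ ≡ r₂ → t + u₃ ≡ r₃ →
      #admissible s ℓ r₁ r₂ r₃ t * s ^ (r₁ + r₂ + r₃) ≤ bound ℓ t u₁ u₂ u₃
    go {u₁ = u₁} {u₂} {u₃} refl refl refl = count-bound ℓ t u₁ u₂ u₃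

proposition1 : (n k : ℕ) → .{{_ : NonZero k}} → 1 ≤ n → k ∣ n →
  (m₁ m₂ m₃ : ℕ) → 3 ≤ m₁ → m₁ ≤ k → 3 ≤ m₂ → m₂ ≤ k → 3 ≤ m₃ → m₃ ≤ k →
  ((L : List (ESet k (n / k))) → AllPairs Differ L →
      All (InCluster k (n / k) m₁ m₂ m₃) L →
      length L * (n / k) ^ (m₁ + m₂ + m₃)
        ≤ (k C 3) * (n / k) ^ (4 * k)
          * (((1 * k) C (m₁ ∸ 3)) * ((2 * k) C (m₂ ∸ 3)) * ((3 * k) C (m₃ ∸ 3))))
  × ((F : ESet k (n / k)) → InCluster k (n / k) m₁ m₂ m₃ F →
      4 * (k C 2) ≤ ecard F + (m₁ C 2) + (m₂ C 2) + (m₃ C 2))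
-- Both bounds hold for any class size n / k.
proposition1 n k _ _ m₁ m₂ m₃ 3≤m₁ _ 3≤m₂ _ 3≤m₃ _ =
  (λ L distinct clusters → begin
    length L * size ^ (m₁ + m₂ + m₃)
      ≤⟨ *-monoˡ-≤ _ (length≤#admissible m₁ m₂ m₃ L distinct clusters) ⟩
    #admissible size k m₁ m₂ m₃ 3 * size ^ (m₁ + m₂ + m₃)
      ≤⟨ Counting.admissible-bound size k 3 3≤m₁ 3≤m₂ 3≤m₃ ⟩
    (k C 3) * ((k C u₁) * (((2 * k) C u₂) * ((3 * k) C u₃))) * size ^ (4 * k)
      ≡⟨ rearrange (k C 3) (k C u₁) ((2 * k) C u₂) ((3 * k) C u₃) (size ^ (4 * k)) ⟩
    (k C 3) * size ^ (4 * k) * ((k C u₁) * ((2 * k) C u₂) * ((3 * k) C u₃))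
      ≡⟨ cong (λ k′ → (k C 3) * size ^ (4 * k) * ((k′ C u₁) * ((2 * k) C u₂) * ((3 * k) C u₃))) (sym (*-identityˡ k)) ⟩
    (k C 3) * size ^ (4 * k) * (((1 * k) C u₁) * ((2 * k) C u₂) * ((3 * k) C u₃)) ∎)
  , λ F → cluster-ecard-bound
  where
  open ≤-Reasoning
  size = n / k
  u₁ = m₁ ∸ 3 ; u₂ = m₂ ∸ 3 ; u₃ = m₃ ∸ 3
  rearrange : ∀ a b c d e → a * (b * (c * d)) * e ≡ a * e * (b * c * d)
  rearrange = solve-∀
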